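{- Let $Q\subseteq\mathbb{F}_2^n$ be a query set and $r,t$ nonnegative integers. If $T(Q,r)\le t$, then $\mathsf{LT}(Q,n+r)\le t+r$.
   Context: Inner products are over $\mathbb{F}_2$. A systematic linear data structure with redundancy $r$ for query set $Q$ fixes $a_1,\dots,a_r\in\mathbb{F}_2^n$; on input $v\in\mathbb{F}_2^n$ it stores $v$ and the bits $\langle a_i,v\rangle$; to answer $q\in Q$ it reads some coordinates of $v$ (possibly depending on $q$) and outputs an $\mathbb{F}_2$-linear combination of the $r$ stored bits and the read coordinates, which must equal $\langle q,v\rangle$ for all $q,v$; its query time is the maximum number of coordinates of $v$ read (the $r$ redundant bits are free). $T(Q,r)$ is the minimum such query time. A linear data structure with space $s$ fixes $b_1,\dots,b_s\in\mathbb{F}_2^n$, stores $\langle b_1,v\rangle,\dots,\langle b_s,v\rangle$, and answers $q$ by an $\mathbb{F}_2$-linear combination of stored bits it reads, which must equal $\langle q,v\rangle$; its query time is the maximum number of stored bits read. $\mathsf{LT}(Q,s)$ is the minimum such query time. -}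

module Defs where

open import Data.Bool using (Bool; true; false; _∧_; _xor_)
open import Data.Nat using (ℕ; zero; suc; _≤_; _+_)
open import Data.Fin using (Fin; zero; suc)
open import Data.Fin.Subset using (Subset; ∣_∣)
open import Data.Vec using (lookup)
open import Data.Product using (Σ; _×_; ∃)
open import Relation.Binary.PropositionalEquality using (_≡_)

-- F₂ is Bool with addition _xor_ and multiplication _∧_.
-- Vectors in F₂^n are functions Fin n → Bool.
F2^ : ℕ → Set
F2^ n = Fin n → Bool

Σ₂ : ∀ {n} → (Fin n → Bool) → Bool
Σ₂ {zero}  f = false
Σ₂ {suc n} f = f zero xor Σ₂ (λ i → f (suc i))

⟨_,_⟩ : ∀ {n} → F2^ n → F2^ n → Bool
⟨ q , v ⟩ = Σ₂ (λ i → q i ∧ v i)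

QuerySet : ℕ → Set₁
QuerySet n = F2^ n → Set

-- A systematic linear data structure with redundancy r for Q with query
-- time ≤ t: vectors a₁..a_r; for each q ∈ Q a set S of coordinates of v
-- read (|S| ≤ t) and F₂-coefficients c (on the r redundant bits) and d
-- (on the read coordinates) such that
--   ⟨q,v⟩ = Σ_i c_i ⟨a_i,v⟩ + Σ_{j ∈ S} d_j v_j   for all v.
SystematicAnswer : ∀ {n r} → (Fin r → F2^ n) → ℕ → F2^ n → Set
SystematicAnswer {n} {r} a t q =
  Σ (Subset n) λ S → (∣ S ∣ ≤ t) × Σ (F2^ r) λ c → Σ (F2^ n) λ d →
    ∀ (v : F2^ n) →
      ⟨ q , v ⟩ ≡ (Σ₂ (λ i → c i ∧ ⟨ a i , v ⟩)
                    xor Σ₂ (λ j → lookup S j ∧ (d j ∧ v j)))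

-- T(Q,r) ≤ t  (T is the minimum query time, so this means some structure
-- achieves query time ≤ t)
T≤ : ∀ {n} → QuerySet n → ℕ → ℕ → Set
T≤ {n} Q r t =
  Σ (Fin r → F2^ n) λ a → ∀ q → Q q → SystematicAnswer a t q

-- A linear data structure with space s for Q with query time ≤ t:
-- vectors b₁..b_s; for each q ∈ Q a set S of stored cells read (|S| ≤ t)
-- and coefficients c such that ⟨q,v⟩ = Σ_{i ∈ S} c_i ⟨b_i,v⟩ for all v.
LinearAnswer : ∀ {n s} → (Fin s → F2^ n) → ℕ → F2^ n → Set
LinearAnswer {n} {s} b t q =
  Σ (Subset s) λ S → (∣ S ∣ ≤ t) × Σ (F2^ s) λ c →
    ∀ (v : F2^ n) →
      ⟨ q , v ⟩ ≡ Σ₂ (λ i → lookup S i ∧ (c i ∧ ⟨ b i , v ⟩))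

LT≤ : ∀ {n} → QuerySet n → ℕ → ℕ → Set
LT≤ {n} Q s t =
  Σ (Fin s → F2^ n) λ b → ∀ q → Q q → LinearAnswer b t q

-- Idea: store the n coordinates of v (as inner products with the standard
-- basis vectors e₁ … eₙ) followed by the r redundant bits ⟨a_i,v⟩.  A
-- systematic answer  ⟨q,v⟩ = Σ_i c_i⟨a_i,v⟩ + Σ_{j∈S} d_j v_j  is then a
-- linear answer that reads the cells S ∪ {all redundant cells}, at most
-- |S| + r ≤ t + r of them, with coefficients d followed by c.
module Submission where

open import Defs
open import Data.Nat using (ℕ; _+_; zero; suc; _≤_)
open import Data.Nat.Properties using (+-mono-≤; ≤-reflexive; ≤-trans)
open import Data.Bool using (Bool; true; false; _∧_; _xor_)
open import Data.Bool.Properties using (xor-comm; xor-assoc; xor-identityʳ)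
open import Data.Fin using (Fin; zero; suc; _↑ˡ_; _↑ʳ_)
open import Data.Fin.Subset using (Subset; ∣_∣; ⊤; inside; outside)
open import Data.Fin.Subset.Properties using (∣⊤∣≡n)
open import Data.Vec as Vec using (_∷_; []; lookup)
import Data.Vec.Properties as Vec
import Data.Vec.Functional as Fun
import Data.Vec.Functional.Properties as Fun
open import Data.Product using (_,_)
open import Relation.Binary.PropositionalEquality
  using (_≡_; refl; sym; trans; cong; cong₂; module ≡-Reasoning)

Σ₂-cong : ∀ {n} {f g : Fin n → Bool} → (∀ i → f i ≡ g i) → Σ₂ f ≡ Σ₂ g
Σ₂-cong {zero}  f≗g = refl
Σ₂-cong {suc n} f≗g = cong₂ _xor_ (f≗g zero) (Σ₂-cong (λ i → f≗g (suc i)))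

Σ₂-false : ∀ n → Σ₂ {n} (λ _ → false) ≡ false
Σ₂-false zero    = refl
Σ₂-false (suc n) = Σ₂-false n

Σ₂-split : ∀ m {n} (f : Fin (m + n) → Bool) →
  Σ₂ f ≡ Σ₂ (λ i → f (i ↑ˡ n)) xor Σ₂ (λ i → f (m ↑ʳ i))
Σ₂-split zero    f = refl
Σ₂-split (suc m) {n} f = begin
  f zero xor Σ₂ (λ i → f (suc i))
    ≡⟨ cong (f zero xor_) (Σ₂-split m (λ i → f (suc i))) ⟩
  f zero xor (Σ₂ (λ i → f (suc (i ↑ˡ n))) xor Σ₂ (λ i → f (suc (m ↑ʳ i))))
    ≡⟨ sym (xor-assoc (f zero) _ _) ⟩
  (f zero xor Σ₂ (λ i → f (suc (i ↑ˡ n)))) xor Σ₂ (λ i → f (suc (m ↑ʳ i)))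
    ∎
  where open ≡-Reasoning

basis : ∀ {n} → Fin n → F2^ n
basis zero    zero    = true
basis zero    (suc i) = false
basis (suc j) zero    = false
basis (suc j) (suc i) = basis j i

⟨basis,-⟩ : ∀ {n} (j : Fin n) (v : F2^ n) → ⟨ basis j , v ⟩ ≡ v j
⟨basis,-⟩ {suc n} zero v = begin
  v zero xor Σ₂ {n} (λ _ → false) ≡⟨ cong (v zero xor_) (Σ₂-false n) ⟩
  v zero xor false                ≡⟨ xor-identityʳ (v zero) ⟩
  v zero                          ∎
  where open ≡-Reasoning
⟨basis,-⟩ (suc j)    v = ⟨basis,-⟩ j (λ i → v (suc i))

∣++∣ : ∀ {m n} (S : Subset m) (T : Subset n) → ∣ S Vec.++ T ∣ ≡ ∣ S ∣ + ∣ T ∣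
∣++∣ []            T = refl
∣++∣ (inside ∷ S)  T = cong suc (∣++∣ S T)
∣++∣ (outside ∷ S) T = ∣++∣ S T

systematic⇒linear : ∀ {n r t} (a : Fin r → F2^ n) (q : F2^ n) →
  SystematicAnswer a t q → LinearAnswer (basis Fun.++ a) (t + r) q
systematic⇒linear {n} {r} {t} a q (S , ∣S∣≤t , c , d , answer) =
  S Vec.++ ⊤ , size , d Fun.++ c , correct
  where
  b : Fin (n + r) → F2^ n
  b = basis Fun.++ a

  size : ∣ S Vec.++ ⊤ ∣ ≤ t + r
  size = ≤-trans (≤-reflexive (∣++∣ S ⊤)) (+-mono-≤ ∣S∣≤t (≤-reflexive (∣⊤∣≡n r)))

  cell : F2^ n → Fin (n + r) → Bool
  cell v i = lookup (S Vec.++ ⊤) i ∧ ((d Fun.++ c) i ∧ ⟨ b i , v ⟩)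

  coordinate-cell : ∀ v j → cell v (j ↑ˡ r) ≡ lookup S j ∧ (d j ∧ v j)
  coordinate-cell v j = cong₂ _∧_ (Vec.lookup-++ˡ S ⊤ j)
    (cong₂ _∧_ (Fun.lookup-++ˡ d c j) (begin
      ⟨ b (j ↑ˡ r) , v ⟩ ≡⟨ cong ⟨_, v ⟩ (Fun.lookup-++ˡ basis a j) ⟩
      ⟨ basis j , v ⟩    ≡⟨ ⟨basis,-⟩ j v ⟩
      v j                ∎))
    where open ≡-Reasoning

  redundant-cell : ∀ v i → cell v (n ↑ʳ i) ≡ c i ∧ ⟨ a i , v ⟩
  redundant-cell v i = cong₂ _∧_
    (trans (Vec.lookup-++ʳ S ⊤ i) (Vec.lookup-replicate i inside))
    (cong₂ _∧_ (Fun.lookup-++ʳ d c i) (cong ⟨_, v ⟩ (Fun.lookup-++ʳ basis a i)))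

  correct : ∀ v → ⟨ q , v ⟩ ≡ Σ₂ (cell v)
  correct v = begin
    ⟨ q , v ⟩                   ≡⟨ answer v ⟩
    redundant xor coordinates   ≡⟨ xor-comm redundant coordinates ⟩
    coordinates xor redundant   ≡⟨ sym (cong₂ _xor_ (Σ₂-cong (coordinate-cell v))
                                                    (Σ₂-cong (redundant-cell v))) ⟩
    Σ₂ (λ j → cell v (j ↑ˡ r)) xor Σ₂ (λ i → cell v (n ↑ʳ i))
                                ≡⟨ sym (Σ₂-split n (cell v)) ⟩
    Σ₂ (cell v)                 ∎
    where
    open ≡-Reasoning
    redundant coordinates : Bool
    redundant   = Σ₂ (λ i → c i ∧ ⟨ a i , v ⟩)
    coordinates = Σ₂ (λ j → lookup S j ∧ (d j ∧ v j))

proposition2p4 : (n : ℕ) (Q : QuerySet n) (r t : ℕ) →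
    T≤ Q r t → LT≤ Q (n + r) (t + r)
proposition2p4 n Q r t (a , answers) =
  basis Fun.++ a , λ q q∈Q → systematic⇒linear a q (answers q q∈Q)
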